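{- Let $G$ be a group of order 2 acting on a finite set $X$, with orbits $X_1,\dots,X_r,X_{r+1},\dots,X_{r+s}$ where $|X_i|=2$ for $1\le i\le r$ and $|X_j|=1$ for $r+1\le j\le r+s$. Then: (i) there is a $G$-perfect nonlinear function $X\to\mathbb F_2$ if and only if $2r\ge s$ and $4\mid(2r+s)$; (ii) if $2r\ge s$ and $4\mid (2r+s)$, then a function $f:X\to\mathbb F_2$ is $G$-perfect nonlinear if and only if $|\{i: 1\le i\le r,\ |X_i\cap f^{ -1}(1)|=1\}|=(2r+s)/4$.
   Context: $\mathbb F_2$ is regarded as the additive group of order 2. A function $f:X\to\mathbb F_2$ is $G$-perfect nonlinear if $2$ divides $|X|$ and for every $\alpha\in G\setminus\{1_G\}$ and every $\sigma\in\mathbb F_2$, $|\{x\in X: f(\alpha x)-f(x)=\sigma\}|=|X|/2$. -}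

module Defs where

open import Level using (Level; _⊔_)
open import Data.Nat using (ℕ; zero; suc; _+_; _*_)
open import Data.Nat.Divisibility using (_∣_)
open import Data.Nat.DivMod using (_/_)
open import Data.Fin using (Fin; zero; suc)
open import Data.Fin.Properties using (_≟_)
open import Data.Product using (Σ; ∃; _×_; _,_)
open import Data.Sum using (_⊎_; inj₁; inj₂)
open import Relation.Nullary using (¬_; Dec; does)
open import Data.Bool using (if_then_else_)
open import Relation.Binary.PropositionalEquality using (_≡_)
open import Algebra.Bundles using (Group)
open import Function.Bundles using (_⇔_)

F₂ : Set
F₂ = Fin 2

_⊖_ : F₂ → F₂ → F₂
zero ⊖ zero = zero
zero ⊖ suc zero = suc zero
suc zero ⊖ zero = suc zero
suc zero ⊖ suc zero = zero

count : ∀ {p} {n : ℕ} {P : Fin n → Set p} → ((x : Fin n) → Dec (P x)) → ℕ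
count {n = zero} P? = 0
count {n = suc n} P? =
  (if does (P? zero) then 1 else 0) + count (λ x → P? (suc x))

HasOrder2 : ∀ {c ℓ} → Group c ℓ → Set (c ⊔ ℓ)
HasOrder2 G = Σ (Fin 2 → Carrier) λ g →
    (∀ i j → g i ≈ g j → i ≡ j) × (∀ h → ∃ λ i → h ≈ g i)
  where open Group G

record Action {c ℓ} (G : Group c ℓ) (n : ℕ) : Set (c ⊔ ℓ) where
  open Group G
  field
    act      : Carrier → Fin n → Fin n
    act-cong : ∀ {g h} → g ≈ h → ∀ x → act g x ≡ act h x
    act-ε    : ∀ x → act ε x ≡ x
    act-∙    : ∀ g h x → act (g ∙ h) x ≡ act g (act h x)

module _ {c ℓ} {G : Group c ℓ} {n : ℕ} (A : Action G n) where
  open Group G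
  open Action A

  InOrbit : Fin n → Fin n → Set c
  InOrbit x y = ∃ λ g → act g x ≡ y

  -- The orbits of the action are X_1,…,X_r (each of size 2) and
  -- X_{r+1},…,X_{r+s} (each of size 1), listed via a bijection
  --   e : (Fin r × Fin 2) ⊎ Fin s → X,
  -- where X_i = {e (inj₁ (i , 0)), e (inj₁ (i , 1))} and X_{r+j} = {e (inj₂ j)}.
  record OrbitDecomposition (r s : ℕ) (e : (Fin r × Fin 2) ⊎ Fin s → Fin n)
         : Set c where
    field
      e-injective  : ∀ u v → e u ≡ e v → u ≡ v
      e-surjective : ∀ x → ∃ λ u → e u ≡ x
      orbit₂ : ∀ i b y →
        InOrbit (e (inj₁ (i , b))) y ⇔ (∃ λ b′ → y ≡ e (inj₁ (i , b′)))
      orbit₁ : ∀ j y → InOrbit (e (inj₂ j)) y ⇔ (y ≡ e (inj₂ j))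

  IsGPerfectNonlinear : (Fin n → F₂) → Set (c ⊔ ℓ)
  IsGPerfectNonlinear f =
    2 ∣ n ×
    (∀ α → ¬ (α ≈ ε) → ∀ σ →
       count (λ x → (f (act α x) ⊖ f x) ≟ σ) ≡ n / 2)

module Submission where

-- Let β be the non-identity element of G. It swaps the two points of each X_i and fixes each
-- X_{r+j}, so the derivative x ↦ f(βx) − f(x) is 1 exactly on the 2k points of the k pairs on
-- which f is non-constant. Perfect nonlinearity asks both values to be taken |X|/2 = (2r+s)/2
-- times, i.e. 2r+s = 4k; since k takes exactly the values 0, …, r, both parts follow.

open import Defs
open import Data.Nat using (ℕ; _+_; _*_; _≤_) renaming (_≟_ to _≟ℕ_)
open import Data.Nat.Divisibility using (_∣_)
open import Data.Nat.DivMod using (_/_)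
open import Data.Fin using (Fin; zero; suc)
open import Data.Fin.Properties using (_≟_)
open import Data.Product using (∃; _×_; _,_)
open import Data.Sum using (_⊎_; inj₁; inj₂)
open import Relation.Binary.PropositionalEquality using (_≡_)
open import Algebra.Bundles using (Group)
open import Function.Bundles using (_⇔_)

open import Data.Bool using (true; false; if_then_else_)
open import Data.Empty using (⊥-elim)
open import Data.Fin using (toℕ; opposite; _↑ˡ_; _↑ʳ_; splitAt; combine; remQuot)
open import Data.Fin.Properties using (+↔⊎; *↔×; splitAt-↑ˡ; splitAt-↑ʳ; remQuot-combine)
open import Data.Nat using (zero; suc; z≤n; s≤s; NonZero; _<ᵇ_)
open import Data.Nat.Divisibility using (divides)
open import Data.Nat.DivMod using (m*n/n≡m; m/n*n≡m; /-monoˡ-≤)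
open import Data.Nat.Properties
  using (+-*-semiring; +-assoc; +-suc; +-identityʳ; *-identityʳ; *-comm; +-cancelʳ-≡; +-cancelˡ-≤;
         *-monoˡ-≤; +-monoʳ-≤; m≤n⇒m≤1+n; module ≤-Reasoning)
open import Data.Nat.Tactic.RingSolver using (solve-∀)
open import Data.Product using (proj₁; proj₂; uncurry)
open import Data.Sum using (map₁; [_,_])
open import Data.Sum.Properties using (inj₁-injective)
open import Data.Product.Properties using (,-injectiveʳ)
open import Data.Sum.Function.Propositional using (_⊎-↔_)
open import Function using (_∘_; const)
open import Function.Bundles using (_↔_; Inverse; Equivalence; mk⇔; mk↔ₛ′)
open import Function.Construct.Composition using (_↔-∘_)
open import Function.Construct.Identity using (↔-id)
open import Function.Properties.Equivalence using () renaming (trans to ⇔-trans)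
open import Relation.Binary.PropositionalEquality
  using (_≢_; refl; sym; trans; cong; cong₂; module ≡-Reasoning)
open import Relation.Nullary using (¬_; Dec; does)
open import Relation.Binary.Definitions using (DecidableEquality)
open import Algebra.Properties.Semiring.Sum +-*-semiring
  using (sum; sum-syntax; sum-cong-≗; sum-permute; sum-replicate-zero; *-distribˡ-sum)

open Equivalence using (to; from)

indicator : ∀ {p} {P : Set p} → Dec P → ℕ
indicator P? = if does P? then 1 else 0

count≡∑ : ∀ {p n} {P : Fin n → Set p} (P? : ∀ x → Dec (P x)) →
          count P? ≡ ∑[ x < n ] indicator (P? x)
count≡∑ {n = zero}  P? = refl
count≡∑ {n = suc n} P? = cong (indicator (P? zero) +_) (count≡∑ (P? ∘ suc))

count-cong : ∀ {p q n} {P : Fin n → Set p} {Q : Fin n → Set q}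
             {P? : ∀ x → Dec (P x)} {Q? : ∀ x → Dec (Q x)} →
             (∀ x → does (P? x) ≡ does (Q? x)) → count P? ≡ count Q?
count-cong {n = zero}  _  = refl
count-cong {n = suc n} eq = cong₂ _+_ (cong (if_then 1 else 0) (eq zero)) (count-cong (eq ∘ suc))

count-≟-cong : ∀ {a} {A : Set a} (_≟ᴬ_ : DecidableEquality A) {n} {v w : Fin n → A} {c : A} →
               (∀ x → v x ≡ w x) → count (λ x → v x ≟ᴬ c) ≡ count (λ x → w x ≟ᴬ c)
count-≟-cong _≟ᴬ_ {c = c} v≗w = count-cong λ x → cong (λ y → does (y ≟ᴬ c)) (v≗w x)

count≤n : ∀ {p n} {P : Fin n → Set p} (P? : ∀ x → Dec (P x)) → count P? ≤ n
count≤n {n = zero}  P? = z≤n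
count≤n {n = suc n} P? with does (P? zero)
... | true  = s≤s (count≤n (P? ∘ suc))
... | false = m≤n⇒m≤1+n (count≤n (P? ∘ suc))

count-≟0+count-≟1 : ∀ {n} (v : Fin n → F₂) →
                    count (λ x → v x ≟ zero) + count (λ x → v x ≟ suc zero) ≡ n
count-≟0+count-≟1 {zero}  v = refl
count-≟0+count-≟1 {suc n} v with v zero | count-≟0+count-≟1 (v ∘ suc)
... | zero     | eq = cong suc eq
... | suc zero | eq = trans (+-suc _ _) (cong suc eq)

∑-const : ∀ n {c} → ∑[ _ < n ] c ≡ n * c
∑-const zero    = refl
∑-const (suc n) = cong (_ +_) (∑-const n)

∑-↑ : ∀ m {n} (g : Fin (m + n) → ℕ) → sum g ≡ ∑[ i < m ] g (i ↑ˡ n) + ∑[ j < n ] g (m ↑ʳ j)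
∑-↑ zero    g = refl
∑-↑ (suc m) g = trans (cong (g zero +_) (∑-↑ m (g ∘ suc))) (sym (+-assoc (g zero) _ _))

∑-combine : ∀ m {n} (g : Fin (m * n) → ℕ) → sum g ≡ ∑[ i < m ] ∑[ j < n ] g (combine i j)
∑-combine zero        g = refl
∑-combine (suc m) {n} g =
  trans (∑-↑ n g) (cong (∑[ j < n ] g (j ↑ˡ m * n) +_) (∑-combine m (g ∘ (n ↑ʳ_))))

orbitIndex : ∀ {r k s} → Fin (r * k + s) ↔ ((Fin r × Fin k) ⊎ Fin s)
orbitIndex = (*↔× ⊎-↔ ↔-id _) ↔-∘ +↔⊎

∑-orbits : ∀ {r k s n} (e : ((Fin r × Fin k) ⊎ Fin s) ↔ Fin n) (h : Fin n → ℕ) →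
           sum h ≡ ∑[ i < r ] ∑[ b < k ] h (Inverse.to e (inj₁ (i , b)))
                     + ∑[ j < s ] h (Inverse.to e (inj₂ j))
∑-orbits {r} {k} {s} e h = begin
  sum h
    ≡⟨ sum-permute h (e ↔-∘ orbitIndex) ⟩
  sum (h′ ∘ Inverse.to orbitIndex)
    ≡⟨ ∑-↑ (r * k) (h′ ∘ Inverse.to orbitIndex) ⟩
  ∑[ x < r * k ] h′ (map₁ (remQuot k) (splitAt (r * k) (x ↑ˡ s)))
    + ∑[ j < s ] h′ (map₁ (remQuot k) (splitAt (r * k) (r * k ↑ʳ j)))
    ≡⟨ cong₂ _+_ (sum-cong-≗ λ x → cong (h′ ∘ map₁ (remQuot k)) (splitAt-↑ˡ (r * k) x s))
                 (sum-cong-≗ λ j → cong (h′ ∘ map₁ (remQuot k)) (splitAt-↑ʳ (r * k) s j)) ⟩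
  ∑[ x < r * k ] h′ (inj₁ (remQuot k x)) + ∑[ j < s ] h′ (inj₂ j)
    ≡⟨ cong (_+ ∑[ j < s ] h′ (inj₂ j)) (trans (∑-combine r (h′ ∘ inj₁ ∘ remQuot k))
         (sum-cong-≗ λ i → sum-cong-≗ λ b → cong (h′ ∘ inj₁) (remQuot-combine i b))) ⟩
  ∑[ i < r ] ∑[ b < k ] h′ (inj₁ (i , b)) + ∑[ j < s ] h′ (inj₂ j)
    ∎
  where
  open ≡-Reasoning
  h′ : (Fin r × Fin k) ⊎ Fin s → ℕ
  h′ = h ∘ Inverse.to e

opposite-≢ : ∀ (b : Fin 2) → opposite b ≢ b
opposite-≢ zero       ()
opposite-≢ (suc zero) ()

≡⊎≡opposite : ∀ (b c : Fin 2) → b ≡ c ⊎ b ≡ opposite c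
≡⊎≡opposite zero       zero       = inj₁ refl
≡⊎≡opposite zero       (suc zero) = inj₂ refl
≡⊎≡opposite (suc zero) zero       = inj₂ refl
≡⊎≡opposite (suc zero) (suc zero) = inj₁ refl

⊖-self : ∀ x → x ⊖ x ≡ zero
⊖-self zero       = refl
⊖-self (suc zero) = refl

#nonconstant : ∀ {r} → (Fin r → Fin 2 → F₂) → ℕ
#nonconstant h = count (λ i → count (λ b → h i b ≟ suc zero) ≟ℕ 1)

#nonconstant-cong : ∀ {r} {h h′ : Fin r → Fin 2 → F₂} →
                    (∀ i b → h i b ≡ h′ i b) → #nonconstant h ≡ #nonconstant h′
#nonconstant-cong h≗h′ = count-≟-cong _≟ℕ_ λ i → count-≟-cong _≟_ (h≗h′ i)

#nonconstant≤ : ∀ {r} (h : Fin r → Fin 2 → F₂) → #nonconstant h ≤ r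
#nonconstant≤ h = count≤n _

∑-derivative-pair : ∀ (u : Fin 2 → F₂) →
  ∑[ b < 2 ] indicator ((u (opposite b) ⊖ u b) ≟ suc zero)
    ≡ 2 * indicator (count (λ b → u b ≟ suc zero) ≟ℕ 1)
∑-derivative-pair u with u zero | u (suc zero)
... | zero     | zero     = refl
... | zero     | suc zero = refl
... | suc zero | zero     = refl
... | suc zero | suc zero = refl

nonconstantOnFirst : ℕ → ∀ {r} → Fin r → Fin 2 → F₂
nonconstantOnFirst q i b = if toℕ i <ᵇ q then b else zero

#nonconstant-nonconstantOnFirst : ∀ {r q} → q ≤ r → #nonconstant (nonconstantOnFirst q {r}) ≡ q
#nonconstant-nonconstantOnFirst {zero}  z≤n       = refl
#nonconstant-nonconstantOnFirst {suc r} z≤n       = #nonconstant-nonconstantOnFirst {r} z≤n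
#nonconstant-nonconstantOnFirst {suc r} (s≤s q≤r) = cong suc (#nonconstant-nonconstantOnFirst q≤r)

≡n/2⇔≡ : ∀ {a b n} → a + b ≡ n → (2 ∣ n × a ≡ n / 2 × b ≡ n / 2) ⇔ a ≡ b
≡n/2⇔≡ {a} {b} {n} a+b≡n = mk⇔ (λ (_ , a≡ , b≡) → trans a≡ (sym b≡)) balanced
  where
  a+a≡a*2 : ∀ a → a + a ≡ a * 2
  a+a≡a*2 = solve-∀
  balanced : a ≡ b → 2 ∣ n × a ≡ n / 2 × b ≡ n / 2
  balanced refl = divides a n≡a*2 , a≡n/2 , a≡n/2
    where
    n≡a*2 : n ≡ a * 2
    n≡a*2 = trans (sym a+b≡n) (a+a≡a*2 a)
    a≡n/2 : a ≡ n / 2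
    a≡n/2 = sym (trans (cong (_/ 2) n≡a*2) (m*n/n≡m a 2))

≡⇔≡*4 : ∀ {a b k m} → a + b ≡ m → b ≡ 2 * k → (a ≡ b ⇔ m ≡ k * 4)
≡⇔≡*4 {a} {k = k} a+b≡m refl = mk⇔ (λ { refl → trans (sym a+b≡m) (2k+2k≡k*4 k) })
  (λ m≡k*4 → +-cancelʳ-≡ (2 * k) a (2 * k) (trans a+b≡m (trans m≡k*4 (sym (2k+2k≡k*4 k)))))
  where
  2k+2k≡k*4 : ∀ k → 2 * k + 2 * k ≡ k * 4
  2k+2k≡k*4 = solve-∀

≡*⇔≡/ : ∀ {m k d} .{{_ : NonZero d}} → d ∣ m → (m ≡ k * d ⇔ k ≡ m / d)
≡*⇔≡/ {k = k} {d} d∣m = mk⇔ (λ { refl → sym (m*n/n≡m k d) }) (λ { refl → sym (m/n*n≡m d∣m) })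

+≡*4⇒≤ : ∀ {r s k} → 2 * r + s ≡ k * 4 → k ≤ r → s ≤ 2 * r
+≡*4⇒≤ {r} {s} {k} 2r+s≡k*4 k≤r = +-cancelˡ-≤ (2 * r) s (2 * r) (begin
  2 * r + s     ≡⟨ 2r+s≡k*4 ⟩
  k * 4         ≤⟨ *-monoˡ-≤ 4 k≤r ⟩
  r * 4         ≡⟨ r*4≡2r+2r r ⟩
  2 * r + 2 * r ∎)
  where
  open ≤-Reasoning
  r*4≡2r+2r : ∀ r → r * 4 ≡ 2 * r + 2 * r
  r*4≡2r+2r = solve-∀

≤⇒/4≤ : ∀ {r s} → s ≤ 2 * r → (2 * r + s) / 4 ≤ r
≤⇒/4≤ {r} {s} s≤2r = begin
  (2 * r + s) / 4     ≤⟨ /-monoˡ-≤ 4 (+-monoʳ-≤ (2 * r) s≤2r) ⟩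
  (2 * r + 2 * r) / 4 ≡⟨ cong (_/ 4) (2r+2r≡r*4 r) ⟩
  r * 4 / 4           ≡⟨ m*n/n≡m r 4 ⟩
  r                   ∎
  where
  open ≤-Reasoning
  2r+2r≡r*4 : ∀ r → 2 * r + 2 * r ≡ r * 4
  2r+2r≡r*4 = solve-∀

module _ {c ℓ} (G : Group c ℓ) where
  open Group G using (_≈_; ε) renaming (trans to ≈-trans; sym to ≈-sym)

  HasOrder2⇒elements : HasOrder2 G → ∃ λ β → ¬ β ≈ ε × (∀ α → α ≈ ε ⊎ α ≈ β)
  HasOrder2⇒elements (g , g-injective , g-surjective) = g (opposite i₀) , β≉ε , ≈ε⊎≈β
    where
    i₀ : Fin 2
    i₀ = proj₁ (g-surjective ε)
    ε≈gi₀ : ε ≈ g i₀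
    ε≈gi₀ = proj₂ (g-surjective ε)
    β≉ε : ¬ g (opposite i₀) ≈ ε
    β≉ε β≈ε = opposite-≢ i₀ (g-injective _ _ (≈-trans β≈ε ε≈gi₀))
    ≈ε⊎≈β : ∀ α → α ≈ ε ⊎ α ≈ g (opposite i₀)
    ≈ε⊎≈β α with g-surjective α
    ... | i , α≈gi with ≡⊎≡opposite i i₀
    ... | inj₁ refl = inj₁ (≈-trans α≈gi (≈-sym ε≈gi₀))
    ... | inj₂ refl = inj₂ α≈gi

module PerfectNonlinearity {c ℓ} {G : Group c ℓ} (order2 : HasOrder2 G) {n} (A : Action G n)
                           {r s e} (OD : OrbitDecomposition A r s e) where
  open Group G using (Carrier; _≈_; ε)
  open Action A
  open OrbitDecomposition OD

  β : Carrier
  β = proj₁ (HasOrder2⇒elements G order2)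

  β≉ε : ¬ β ≈ ε
  β≉ε = proj₁ (proj₂ (HasOrder2⇒elements G order2))

  ≈ε⊎≈β : ∀ α → α ≈ ε ⊎ α ≈ β
  ≈ε⊎≈β = proj₂ (proj₂ (HasOrder2⇒elements G order2))

  act-nonidentity : ∀ α → ¬ α ≈ ε → ∀ x → act α x ≡ act β x
  act-nonidentity α α≉ε x with ≈ε⊎≈β α
  ... | inj₁ α≈ε = ⊥-elim (α≉ε α≈ε)
  ... | inj₂ α≈β = act-cong α≈β x

  fixed-by-β⇒fixed : ∀ {x} → act β x ≡ x → ∀ α → act α x ≡ x
  fixed-by-β⇒fixed {x} βx≡x α with ≈ε⊎≈β α
  ... | inj₁ α≈ε = trans (act-cong α≈ε x) (act-ε x)
  ... | inj₂ α≈β = trans (act-cong α≈β x) βx≡x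

  act-β-singleton : ∀ j → act β (e (inj₂ j)) ≡ e (inj₂ j)
  act-β-singleton j = to (orbit₁ j _) (β , refl)

  -- Were x fixed by β it would be fixed by all of G, yet its orbit has a second point.
  act-β-pair-≢ : ∀ i b → act β (e (inj₁ (i , b))) ≢ e (inj₁ (i , b))
  act-β-pair-≢ i b βx≡x with from (orbit₂ i b _) (opposite b , refl)
  ... | α , αx≡y = opposite-≢ b (sym (,-injectiveʳ (inj₁-injective
                     (e-injective _ _ (trans (sym (fixed-by-β⇒fixed βx≡x α)) αx≡y)))))

  act-β-pair : ∀ i b → act β (e (inj₁ (i , b))) ≡ e (inj₁ (i , opposite b))
  act-β-pair i b with to (orbit₂ i b _) (β , refl)
  ... | b′ , βx≡y with ≡⊎≡opposite b′ b
  ... | inj₁ refl = ⊥-elim (act-β-pair-≢ i b βx≡y)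
  ... | inj₂ refl = βx≡y

  e⁻¹ : Fin n → (Fin r × Fin 2) ⊎ Fin s
  e⁻¹ = proj₁ ∘ e-surjective

  e⁻¹∘e : ∀ u → e⁻¹ (e u) ≡ u
  e⁻¹∘e u = e-injective _ _ (proj₂ (e-surjective (e u)))

  e↔ : ((Fin r × Fin 2) ⊎ Fin s) ↔ Fin n
  e↔ = mk↔ₛ′ e e⁻¹ (proj₂ ∘ e-surjective) e⁻¹∘e

  n≡2r+s : n ≡ 2 * r + s
  n≡2r+s = begin
    n                              ≡⟨ sym (*-identityʳ n) ⟩
    n * 1                          ≡⟨ sym (∑-const n) ⟩
    ∑[ _ < n ] 1                   ≡⟨ ∑-orbits e↔ _ ⟩
    ∑[ _ < r ] 2 + ∑[ _ < s ] 1    ≡⟨ cong₂ _+_ (∑-const r) (∑-const s) ⟩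
    r * 2 + s * 1                  ≡⟨ cong₂ _+_ (*-comm r 2) (*-identityʳ s) ⟩
    2 * r + s                      ∎
    where open ≡-Reasoning

  derivative : (Fin n → F₂) → Carrier → Fin n → F₂
  derivative f α x = f (act α x) ⊖ f x

  onPairs : (Fin n → F₂) → Fin r → Fin 2 → F₂
  onPairs f i b = f (e (inj₁ (i , b)))

  derivative-pair : ∀ f i b →
    derivative f β (e (inj₁ (i , b))) ≡ onPairs f i (opposite b) ⊖ onPairs f i b
  derivative-pair f i b = cong (λ y → f y ⊖ onPairs f i b) (act-β-pair i b)

  derivative-singleton : ∀ f j → derivative f β (e (inj₂ j)) ≡ zero
  derivative-singleton f j = trans (cong (λ y → f y ⊖ f (e (inj₂ j))) (act-β-singleton j)) (⊖-self _)

  #derivative : (Fin n → F₂) → F₂ → ℕ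
  #derivative f σ = count (λ x → derivative f β x ≟ σ)

  #derivative≡1 : ∀ f → #derivative f (suc zero) ≡ 2 * #nonconstant (onPairs f)
  #derivative≡1 f = begin
    count (λ x → D x ≟ suc zero)
      ≡⟨ count≡∑ (λ x → D x ≟ suc zero) ⟩
    ∑[ x < n ] [D≡1] x
      ≡⟨ ∑-orbits e↔ [D≡1] ⟩
    ∑[ i < r ] ∑[ b < 2 ] [D≡1] (e (inj₁ (i , b))) + ∑[ j < s ] [D≡1] (e (inj₂ j))
      ≡⟨ cong₂ _+_ (sum-cong-≗ λ i → trans (sum-cong-≗ λ b → cong [≡1] (derivative-pair f i b))
                                           (∑-derivative-pair (onPairs f i)))
                   (trans (sum-cong-≗ λ j → cong [≡1] (derivative-singleton f j))
                          (sum-replicate-zero s)) ⟩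
    ∑[ i < r ] (2 * [nonconstant] i) + 0
      ≡⟨ trans (+-identityʳ _) (sym (*-distribˡ-sum 2 [nonconstant])) ⟩
    2 * ∑[ i < r ] [nonconstant] i
      ≡⟨ cong (2 *_) (sym (count≡∑ (λ i → count (λ b → onPairs f i b ≟ suc zero) ≟ℕ 1))) ⟩
    2 * #nonconstant (onPairs f)
      ∎
    where
    open ≡-Reasoning
    D : Fin n → F₂
    D = derivative f β
    [≡1] : F₂ → ℕ
    [≡1] d = indicator (d ≟ suc zero)
    [D≡1] : Fin n → ℕ
    [D≡1] = [≡1] ∘ D
    [nonconstant] : Fin r → ℕ
    [nonconstant] i = indicator (count (λ b → onPairs f i b ≟ suc zero) ≟ℕ 1)

  perfectNonlinear⇔balanced : ∀ f → IsGPerfectNonlinear A f ⇔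
    (2 ∣ n × #derivative f zero ≡ n / 2 × #derivative f (suc zero) ≡ n / 2)
  perfectNonlinear⇔balanced f = mk⇔
    (λ (2∣n , balanced) → 2∣n , balanced β β≉ε zero , balanced β β≉ε (suc zero))
    (λ (2∣n , #0 , #1) → 2∣n , λ α α≉ε σ →
      trans (count-≟-cong _≟_ λ x → cong (λ y → f y ⊖ f x) (act-nonidentity α α≉ε x))
            (bothValues {λ σ → #derivative f σ ≡ n / 2} #0 #1 σ))
    where
    bothValues : ∀ {P : F₂ → Set} → P zero → P (suc zero) → ∀ σ → P σ
    bothValues p₀ p₁ zero       = p₀
    bothValues p₀ p₁ (suc zero) = p₁

  perfectNonlinear⇔ : ∀ f → IsGPerfectNonlinear A f ⇔ 2 * r + s ≡ #nonconstant (onPairs f) * 4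
  perfectNonlinear⇔ f =
    ⇔-trans (perfectNonlinear⇔balanced f)
      (⇔-trans (≡n/2⇔≡ #0+#1≡n)
               (≡⇔≡*4 {k = #nonconstant (onPairs f)} (trans #0+#1≡n n≡2r+s) (#derivative≡1 f)))
    where
    #0+#1≡n : #derivative f zero + #derivative f (suc zero) ≡ n
    #0+#1≡n = count-≟0+count-≟1 (derivative f β)

  realisable : ∀ {q} → q ≤ r → ∃ λ f → #nonconstant (onPairs f) ≡ q
  realisable {q} q≤r = F ∘ e⁻¹ , trans (#nonconstant-cong λ i b → cong F (e⁻¹∘e (inj₁ (i , b))))
                                       (#nonconstant-nonconstantOnFirst q≤r)
    where
    F : (Fin r × Fin 2) ⊎ Fin s → F₂
    F = [ uncurry (nonconstantOnFirst q) , const zero ]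

theorem4p7 : ∀ {c ℓ} (G : Group c ℓ) → HasOrder2 G →
    (n : ℕ) (A : Action G n) (r s : ℕ) (e : (Fin r × Fin 2) ⊎ Fin s → Fin n) →
    OrbitDecomposition A r s e →
      ((∃ λ (f : Fin n → F₂) → IsGPerfectNonlinear A f) ⇔ (s ≤ 2 * r × 4 ∣ 2 * r + s))
      × (s ≤ 2 * r → 4 ∣ 2 * r + s → (f : Fin n → F₂) →
           IsGPerfectNonlinear A f
             ⇔ (count (λ i → count (λ b → f (e (inj₁ (i , b))) ≟ suc zero) ≟ℕ 1)
                  ≡ (2 * r + s) / 4))
theorem4p7 G order2 n A r s e OD = mk⇔ necessary sufficient , characterisation
  where
  open PerfectNonlinearity order2 A OD

  characterisation : s ≤ 2 * r → 4 ∣ 2 * r + s → ∀ f →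
                     IsGPerfectNonlinear A f ⇔ #nonconstant (onPairs f) ≡ (2 * r + s) / 4
  characterisation _ 4∣2r+s f = ⇔-trans (perfectNonlinear⇔ f) (≡*⇔≡/ 4∣2r+s)

  necessary : (∃ λ f → IsGPerfectNonlinear A f) → s ≤ 2 * r × 4 ∣ 2 * r + s
  necessary (f , perfect) = +≡*4⇒≤ 2r+s≡k*4 (#nonconstant≤ (onPairs f)) , divides k 2r+s≡k*4
    where
    k : ℕ
    k = #nonconstant (onPairs f)
    2r+s≡k*4 : 2 * r + s ≡ k * 4
    2r+s≡k*4 = to (perfectNonlinear⇔ f) perfect

  sufficient : s ≤ 2 * r × 4 ∣ 2 * r + s → ∃ λ f → IsGPerfectNonlinear A f
  sufficient (s≤2r , 4∣2r+s) with realisable (≤⇒/4≤ s≤2r)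
  ... | f , k≡ = f , from (characterisation s≤2r 4∣2r+s f) k≡
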